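{- Assume (i) $t_{u,v}+t_{v,w}\ge t_{u,w}$ for all $u,v,w\in\{0,\dots,n\}$, and (ii) every single-customer route is warp-free: $\max(t_{0,z},a_z)\le\min(b_z,\,T-s_z-t_{z,0})$ for all $1\le z\le n$. Let $0\le i<j<n$ and suppose the route $P(i,j)$ warps, i.e. $B(i,z)>0$ for some $i<z\le j$, and let $x$ be the smallest such $z$. Then $x\in\mathcal{W}_{0,n}$.
   Context: Customers $1,\dots,n$ in tour order, depot $0$; travel times $t_{u,v}\ge0$, service times $s_z\ge0$ ($s_0=0$), time windows $[a_z,b_z]$, day length $T$. For a route $P(i,j)$ serving customers $i+1,\dots,j$ from the depot, define $A(i,i+1)=\max(t_{0,i+1},a_{i+1})$, $B(i,i+1)=0$, and for $z\ge i+2$: $A(i,z)=\max(A(i,z-1)-B(i,z-1)+s_{z-1}+t_{z-1,z},\,a_z)$, $B(i,z)=\max\big(0,\,A(i,z)-\min(b_z,T-s_z-t_{z,0})\big)$ (time warp at $z$). Define $W[0]=0$ and $\mathrm{dur}=0$, and for $z=1,\dots,n$: $\mathrm{dur}\leftarrow\max(\mathrm{dur}+s_{z-1}+t_{z-1,z},a_z)$, $\ell=\min(b_z,T-s_z-t_{z,0})$; if $\mathrm{dur}>\ell$ then $W[z]=W[z-1]+\mathrm{dur}-\ell$ and $\mathrm{dur}\leftarrow\ell$, else $W[z]=W[z-1]$. Thus $W[z]$ is the accumulated warp of the whole tour $0,1,\dots,z$. Let $\mathcal{W}_{0,n}=\{z\in\{2,\dots,n\}: W[z]\ne W[z-1]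\}$.
   Formalization: The travel times, service times, time windows and the day length T are all rational numbers. -}

module Defs where

open import Data.Nat as ℕ using (ℕ; zero; suc; _∸_)
open import Data.Rational using (ℚ; 0ℚ; _+_; _-_; _⊔_; _⊓_; _≤ᵇ_)
open import Data.Product using (_×_; _,_; proj₁; proj₂)
open import Data.Bool using (if_then_else_)

-- Instance data: travel times t u v, service times s z, windows [a z, b z],
-- day length T.  Nodes are natural numbers; 0 is the depot, 1..n customers.

latest : (ℕ → ℕ → ℚ) → (ℕ → ℚ) → (ℕ → ℚ) → ℚ → ℕ → ℚ
latest t s b T z = b z ⊓ ((T - s z) - t z 0)

-- ABk t s a b T i k = (A(i, i+1+k), B(i, i+1+k))
ABk : (ℕ → ℕ → ℚ) → (ℕ → ℚ) → (ℕ → ℚ) → (ℕ → ℚ) → ℚ → ℕ → ℕ → ℚ × ℚ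
ABk t s a b T i zero = (t 0 (suc i) ⊔ a (suc i)) , 0ℚ
ABk t s a b T i (suc k) =
  let prev = ABk t s a b T i k
      z₋ = suc (i ℕ.+ k)
      z  = suc z₋
      A  = (((proj₁ prev - proj₂ prev) + s z₋) + t z₋ z) ⊔ a z
  in A , (0ℚ ⊔ (A - latest t s b T z))

-- A(i,z) and B(i,z) for the route P(i,j), meaningful for z ≥ i+1
Aᵢ : (ℕ → ℕ → ℚ) → (ℕ → ℚ) → (ℕ → ℚ) → (ℕ → ℚ) → ℚ → ℕ → ℕ → ℚ
Aᵢ t s a b T i z = proj₁ (ABk t s a b T i (z ∸ suc i))

Bᵢ : (ℕ → ℕ → ℚ) → (ℕ → ℚ) → (ℕ → ℚ) → (ℕ → ℚ) → ℚ → ℕ → ℕ → ℚ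
Bᵢ t s a b T i z = proj₂ (ABk t s a b T i (z ∸ suc i))

-- (dur, W[z]) after processing customers 1..z of the whole tour
durW : (ℕ → ℕ → ℚ) → (ℕ → ℚ) → (ℕ → ℚ) → (ℕ → ℚ) → ℚ → ℕ → ℚ × ℚ
durW t s a b T zero = 0ℚ , 0ℚ
durW t s a b T (suc z₋) =
  let prev = durW t s a b T z₋
      z = suc z₋
      d = ((proj₁ prev + s z₋) + t z₋ z) ⊔ a z
      ℓ = latest t s b T z
  in if d ≤ᵇ ℓ then (d , proj₂ prev) else (ℓ , proj₂ prev + (d - ℓ))

W : (ℕ → ℕ → ℚ) → (ℕ → ℚ) → (ℕ → ℚ) → (ℕ → ℚ) → ℚ → ℕ → ℚ
W t s a b T z = proj₂ (durW t s a b T z)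

-- The whole tour reaches every customer z no earlier than the direct trip from the depot
-- (triangle inequality), and single-customer routes are warp-free, so the tour starts
-- customer i+1 no earlier than P(i,j) does.  Both recurrences are monotone, hence the
-- tour's clamped start time dur(z) dominates A(i,z) - B(i,z) for every z.  Where the route
-- warps, A(i,z) exceeds the latest start at z, so the tour's unclamped start at z, which
-- dominates A(i,z), exceeds it as well and W grows at z.
module Submission where

open import Defs
open import Data.Bool using (true; false; T; if_then_else_)
open import Data.Empty using (⊥-elim)
open import Data.Nat as ℕ using (ℕ; zero; suc; pred)
import Data.Nat.Properties as ℕ
open import Data.Product using (_×_; _,_; proj₁; proj₂)
open import Data.Rational as ℚ using (ℚ; 0ℚ; _+_; _-_; _⊔_; _⊓_)
open import Data.Rational.Properties
open import Data.Rational.Solver using (module +-*-Solver)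
open import Relation.Binary.PropositionalEquality
  using (_≡_; _≢_; refl; sym; subst)
open import Relation.Nullary using (¬_)

p-[p-q]≡q : ∀ p q → p - (p - q) ≡ q
p-[p-q]≡q = solve 2 (λ p q → p :- (p :- q) := q) refl
  where open +-*-Solver

p-[0⊔[p-q]]≤p⊓q : ∀ p q → p - (0ℚ ⊔ (p - q)) ℚ.≤ p ⊓ q
p-[0⊔[p-q]]≤p⊓q p q = ⊓-glb below-p below-q
  where
  below-p : p - (0ℚ ⊔ (p - q)) ℚ.≤ p
  below-p = subst (p - (0ℚ ⊔ (p - q)) ℚ.≤_) (+-identityʳ p)
                  (+-monoʳ-≤ p (neg-antimono-≤ (p≤p⊔q 0ℚ (p - q))))
  below-q : p - (0ℚ ⊔ (p - q)) ℚ.≤ q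
  below-q = subst (p - (0ℚ ⊔ (p - q)) ℚ.≤_) (p-[p-q]≡q p q)
                  (+-monoʳ-≤ p (neg-antimono-≤ (p≤q⊔p 0ℚ (p - q))))

0<0⊔[p-q]⇒q<p : ∀ p q → 0ℚ ℚ.< 0ℚ ⊔ (p - q) → q ℚ.< p
0<0⊔[p-q]⇒q<p p q 0<warp = ≰⇒> λ p≤q →
  <-irrefl (sym (p≥q⇒p⊔q≡p (p-q≤0 p≤q))) 0<warp
  where
  p-q≤0 : p ℚ.≤ q → p - q ℚ.≤ 0ℚ
  p-q≤0 p≤q = subst (p - q ℚ.≤_) (+-inverseʳ q) (+-monoˡ-≤ (ℚ.- q) p≤q)

q<p⇒r<r+[p-q] : ∀ {p q} r → q ℚ.< p → r ℚ.< r + (p - q)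
q<p⇒r<r+[p-q] {p} {q} r q<p = subst (ℚ._< r + (p - q)) (+-identityʳ r)
  (+-monoʳ-< r (subst (ℚ._< p - q) (+-inverseʳ q) (+-monoˡ-< (ℚ.- q) q<p)))

p≤p+q : ∀ {p q} → 0ℚ ℚ.≤ q → p ℚ.≤ p + q
p≤p+q {p} 0≤q = subst (ℚ._≤ p + _) (+-identityʳ p) (+-monoʳ-≤ p 0≤q)

-- durW (suc z) unfolds definitionally to clamp (startAfter z) (latest … (suc z)) (W … z).
clamp : ℚ → ℚ → ℚ → ℚ × ℚ
clamp d ℓ w = if d ℚ.≤ᵇ ℓ then (d , w) else (ℓ , w + (d - ℓ))

clamp-glb : ∀ {c d ℓ} w → c ℚ.≤ d → c ℚ.≤ ℓ → c ℚ.≤ proj₁ (clamp d ℓ w)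
clamp-glb {d = d} {ℓ} w c≤d c≤ℓ with d ℚ.≤ᵇ ℓ
... | true  = c≤d
... | false = c≤ℓ

clamp-warps : ∀ {d ℓ} w → ℓ ℚ.< d → proj₂ (clamp d ℓ w) ≢ w
clamp-warps {d} {ℓ} w ℓ<d with d ℚ.≤ᵇ ℓ in d≤ᵇℓ
... | true  = λ _ → <-irrefl refl (<-≤-trans ℓ<d (≤ᵇ⇒≤ (subst T (sym d≤ᵇℓ) _)))
... | false = λ w+[d-ℓ]≡w → <-irrefl (sym w+[d-ℓ]≡w) (q<p⇒r<r+[p-q] w ℓ<d)

module Tour (n : ℕ) (t : ℕ → ℕ → ℚ) (s a b : ℕ → ℚ) (T : ℚ)
  (s≥0 : ∀ z → z ℕ.≤ n → 0ℚ ℚ.≤ s z)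
  (s₀≡0 : s 0 ≡ 0ℚ)
  (triangle : ∀ u v w → u ℕ.≤ n → v ℕ.≤ n → w ℕ.≤ n → t u w ℚ.≤ t u v + t v w)
  (direct-feasible : ∀ z → 1 ℕ.≤ z → z ℕ.≤ n → t 0 z ⊔ a z ℚ.≤ latest t s b T z)
  where

  dur : ℕ → ℚ
  dur z = proj₁ (durW t s a b T z)

  arrival : ℕ → ℚ
  arrival z = (dur z + s z) + t z (suc z)

  startAfter : ℕ → ℚ
  startAfter z = arrival z ⊔ a (suc z)

  direct≤arrival : ∀ z → suc z ℕ.≤ n → t 0 (suc z) ℚ.≤ arrival z
  direct≤dur : ∀ z → suc z ℕ.≤ n → t 0 (suc z) ℚ.≤ dur (suc z)

  direct≤arrival zero _ rewrite s₀≡0 = ≤-reflexive (sym (+-identityˡ (t 0 1)))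
  direct≤arrival (suc z) sz<n = ≤-trans (triangle 0 (suc z) (suc (suc z)) ℕ.z≤n sz≤n sz<n)
    (+-monoˡ-≤ (t (suc z) (suc (suc z)))
      (≤-trans (direct≤dur z sz≤n) (p≤p+q (s≥0 (suc z) sz≤n))))
    where
    sz≤n : suc z ℕ.≤ n
    sz≤n = ℕ.<⇒≤ sz<n

  direct≤dur z sz≤n = clamp-glb (W t s a b T z)
    (≤-trans (direct≤arrival z sz≤n) (p≤p⊔q _ _))
    (≤-trans (p≤p⊔q _ _) (direct-feasible (suc z) (ℕ.s≤s ℕ.z≤n) sz≤n))

  module Route (i : ℕ) (i<n : i ℕ.< n) where

    A B : ℕ → ℚ
    A k = proj₁ (ABk t s a b T i k)
    B k = proj₂ (ABk t s a b T i k)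

    A-B≤dur : ∀ k → A k - B k ℚ.≤ dur (suc (i ℕ.+ k))
    A≤startAfter : ∀ k → A (suc k) ℚ.≤ startAfter (suc (i ℕ.+ k))

    A-B≤dur zero rewrite ℕ.+-identityʳ i | +-identityʳ (A 0) = clamp-glb (W t s a b T i)
      (⊔-monoˡ-≤ (a (suc i)) (direct≤arrival i i<n))
      (direct-feasible (suc i) (ℕ.s≤s ℕ.z≤n) i<n)
    A-B≤dur (suc k) rewrite ℕ.+-suc i k = clamp-glb (W t s a b T (suc (i ℕ.+ k)))
      (≤-trans (p≤q⊓r⇒p≤q _ ℓ A-B≤A⊓ℓ) (A≤startAfter k))
      (p≤q⊓r⇒p≤r (A (suc k)) _ A-B≤A⊓ℓ)
      where
      ℓ : ℚ
      ℓ = latest t s b T (suc (suc (i ℕ.+ k)))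
      A-B≤A⊓ℓ : A (suc k) - B (suc k) ℚ.≤ A (suc k) ⊓ ℓ
      A-B≤A⊓ℓ = p-[0⊔[p-q]]≤p⊓q (A (suc k)) ℓ

    A≤startAfter k = ⊔-monoˡ-≤ (a (suc (suc (i ℕ.+ k))))
      (+-monoˡ-≤ (t (suc (i ℕ.+ k)) (suc (suc (i ℕ.+ k))))
        (+-monoˡ-≤ (s (suc (i ℕ.+ k))) (A-B≤dur k)))

    route-warp⇒tour-warp : ∀ k → 0ℚ ℚ.< B (suc k) →
      W t s a b T (suc (suc (i ℕ.+ k))) ≢ W t s a b T (suc (i ℕ.+ k))
    route-warp⇒tour-warp k 0<B = clamp-warps (W t s a b T (suc (i ℕ.+ k)))
      (<-≤-trans (0<0⊔[p-q]⇒q<p (A (suc k)) _ 0<B) (A≤startAfter k))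

    warp-position : ∀ x → i ℕ.< x → 0ℚ ℚ.< Bᵢ t s a b T i x →
      (2 ℕ.≤ x) × (W t s a b T x ≢ W t s a b T (pred x))
    warp-position x i<x 0<B with x ℕ.∸ suc i | ℕ.m+[n∸m]≡n i<x
    ... | zero  | _    = ⊥-elim (<-irrefl refl 0<B)
    ... | suc k | refl rewrite ℕ.+-suc i k = ℕ.s≤s (ℕ.s≤s ℕ.z≤n) , route-warp⇒tour-warp k 0<B

lemma4 : (n : ℕ) (t : ℕ → ℕ → ℚ) (s a b : ℕ → ℚ) (T : ℚ) →
    (∀ u v → u ℕ.≤ n → v ℕ.≤ n → 0ℚ ℚ.≤ t u v) →
    (∀ z → z ℕ.≤ n → 0ℚ ℚ.≤ s z) →
    s 0 ≡ 0ℚ →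
    (∀ u v w → u ℕ.≤ n → v ℕ.≤ n → w ℕ.≤ n → t u w ℚ.≤ t u v + t v w) →
    (∀ z → 1 ℕ.≤ z → z ℕ.≤ n → t 0 z ⊔ a z ℚ.≤ latest t s b T z) →
    (i j x : ℕ) → i ℕ.< j → j ℕ.< n →
    i ℕ.< x → x ℕ.≤ j → 0ℚ ℚ.< Bᵢ t s a b T i x →
    (∀ z → i ℕ.< z → z ℕ.< x → ¬ (0ℚ ℚ.< Bᵢ t s a b T i z)) →
    (2 ℕ.≤ x) × (x ℕ.≤ n) × (W t s a b T x ≢ W t s a b T (pred x))
lemma4 n t s a b T _ s≥0 s₀≡0 triangle direct-feasible i j x i<j j<n i<x x≤j 0<B _
  with Route.warp-position i (ℕ.<-trans i<j j<n) x i<x 0<B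
  where open Tour n t s a b T s≥0 s₀≡0 triangle direct-feasible
... | 2≤x , tour-warps = 2≤x , ℕ.≤-trans x≤j (ℕ.<⇒≤ j<n) , tour-warps
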